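{- Let $(G,A)$ be a simple edge-weighted graph on $n$ vertices and let $v_i,v_j$ be distinct vertices of $G$. Let $(H,B)$ be the edge-weighted graph on the two vertices $v_i,v_j$ obtained from $(G,A)$ by deleting all other vertices one at a time by star-clique operations, collapsing multiple edges whenever they arise (so $H$ is $K_2$ when $G$ is connected). Then the map $\phi:S_G\to S_H$, $\phi(g_1,\dots,g_n)=(g_i,g_j)$, is a surjective $\mathbb{Z}$-module homomorphism.
   Context: An edge-weighted graph $(G,A)$ is a finite loopless graph (multiple edges allowed unless "simple" is stated) with a weight function $A$ from its edges to positive integers. A spline on $(G,A)$ with vertices $v_1,\dots,v_n$ is $(g_1,\dots,g_n)\in\mathbb{Z}^n$ with $g_k\equiv g_l\pmod{A(e)}$ for every edge $e$ joining $v_k$ and $v_l$; $S_G$ is the $\mathbb{Z}$-module of splines. Star-clique on a vertex $v$ (of a graph without multiple edges) with neighbours $w_1,\dots,w_d$ and edge $vw_k$ of weight $a_k$: delete $v$ and its incident edges and, for each pair $s<t$, add a new edge between $w_s$ and $w_t$ of weight $\gcd(a_s,a_t)$ (possibly creating multiple edges). Edge collapse: replace edges $e_1,\dots,e_r$ ($r\ge2$) joining the same pair of vertices, of weights $a_1,\dots,a_r$, by one edge of weight $\operatorname{lcm}(a_1,\dots,a_r)$. -}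

module Defs where

open import Data.Nat using (ℕ; _≤_)
open import Data.Nat.GCD using (gcd)
open import Data.Nat.LCM using (lcm)
open import Data.Integer using (ℤ; +_; _-_; _+_; _*_)
open import Data.Integer.Divisibility using (_∣_)
open import Data.Fin using (Fin; _≟_) renaming (zero to f0; suc to fs)
open import Data.Maybe using (Maybe; just; nothing)
open import Data.Bool using (if_then_else_; _∨_)
open import Data.List using (List; foldl)
open import Relation.Nullary using (does)
open import Relation.Binary.PropositionalEquality using (_≡_)

-- An edge-weighted graph without multiple edges on vertex set Fin n:
-- W k l ≡ just a  means there is an edge between v_k and v_l of weight a;
-- W k l ≡ nothing means there is no such edge.
WGraph : ℕ → Set
WGraph n = Fin n → Fin n → Maybe ℕ

record IsSimpleWGraph {n : ℕ} (W : WGraph n) : Set where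
  field
    loopless  : ∀ k → W k k ≡ nothing
    symmetric : ∀ k l → W k l ≡ W l k
    positive  : ∀ k l a → W k l ≡ just a → 1 ≤ a

IsSpline : {n : ℕ} → WGraph n → (Fin n → ℤ) → Set
IsSpline {n} W g = ∀ (k l : Fin n) (a : ℕ) → W k l ≡ just a → (+ a) ∣ (g k - g l)

collapse : Maybe ℕ → Maybe ℕ → Maybe ℕ
collapse nothing  m        = m
collapse (just a) nothing  = just a
collapse (just a) (just b) = just (lcm a b)

-- New edge created by star-clique between two neighbours of v with weights a, b.
cliqueEdge : Maybe ℕ → Maybe ℕ → Maybe ℕ
cliqueEdge (just a) (just b) = just (gcd a b)
cliqueEdge _        _        = nothing

-- The deleted vertex v is kept as an isolated index (all its edges removed);
-- vertices are tracked by their original labels.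
starCliqueCollapse : {n : ℕ} → Fin n → WGraph n → WGraph n
starCliqueCollapse v W x y =
  if does (x ≟ v) ∨ does (y ≟ v) then nothing
  else (if does (x ≟ y) then W x y
        else collapse (W x y) (cliqueEdge (W v x) (W v y)))

reduceAlong : {n : ℕ} → List (Fin n) → WGraph n → WGraph n
reduceAlong vs W = foldl (λ U v → starCliqueCollapse v U) W vs

twoVertexGraph : {n : ℕ} → WGraph n → Fin n → Fin n → WGraph 2
twoVertexGraph B i j f0 (fs f0) = B i j
twoVertexGraph B i j (fs f0) f0 = B j i
twoVertexGraph B i j _ _ = nothing

restrict2 : {n : ℕ} → Fin n → Fin n → (Fin n → ℤ) → (Fin 2 → ℤ)
restrict2 i j g f0 = g i
restrict2 i j g (fs _) = g j

-- A spline on the graph survives the deletion of a vertex v by star-clique and collapse: the new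
-- edge xy of weight gcd(a_x, a_y) is implied by g_x ≡ g_v ≡ g_y, and collapsing parallel edges
-- into one of weight lcm is exactly the conjunction of their congruences.  Conversely, a spline
-- of the reduced graph extends over v: the value at v must solve g_v ≡ g_x (mod a_x) for all
-- neighbours x, and the clique edges say precisely that these congruences agree modulo
-- gcd(a_x, a_y), which is what the generalised Chinese remainder theorem needs.  Iterating,
-- the deleted vertices end up isolated, so every spline on the two-vertex graph H lifts.

module Submission where

open import Defs
open import Data.Nat using (ℕ; zero; suc; ≢-nonZero)
import Data.Nat as ℕ
import Data.Nat.Properties as ℕ
open import Data.Nat.Divisibility
  using (_∣_; module ∣-Reasoning; ∣-refl; ∣-trans; ∣-antisym; ∣-reflexive; _∣0; 1∣_;
         *-pres-∣; *-cancelʳ-∣)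
open import Data.Nat.GCD
open import Data.Nat.LCM
open import Data.Integer using (ℤ; +_; -_; _+_; _-_; _*_; ∣_∣)
import Data.Integer.Properties as ℤ
import Data.Integer.Divisibility.Signed as Signed
open import Data.Integer.Tactic.RingSolver using (solve-∀)
open import Data.Fin using (Fin; _≟_) renaming (zero to f0; suc to fs)
open import Data.Maybe using (Maybe; just; nothing)
open import Data.Bool using (if_then_else_)
open import Data.Vec.Functional using (foldr; tail; updateAt)
open import Data.Vec.Functional.Properties using (updateAt-updates; updateAt-minimal)
open import Data.List using (List; []; _∷_)
open import Data.List.Membership.Propositional using (_∈_; _∉_)
open import Data.List.Relation.Unary.Any using (here; there)
open import Data.List.Relation.Unary.Unique.Propositional using (Unique)
open import Data.Product using (Σ; _×_; _,_; proj₁; proj₂)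
open import Data.Sum using (_⊎_; inj₁; inj₂; [_,_])
open import Function using (const; _∘_)
open import Relation.Nullary using (¬_; yes; no; does; contradiction)
open import Relation.Nullary.Decidable using (dec-true; dec-false)
open import Relation.Binary.PropositionalEquality hiding ([_])

-- Congruences and the Chinese remainder theorem

infix 4 _≡_mod_

record _≡_mod_ (x y : ℤ) (m : ℕ) : Set where
  constructor ≡-mod
  field divisibility : m ∣ ∣ x - y ∣
open _≡_mod_ public

module _ {m : ℕ} where

  ≡-mod⇒∣ : ∀ {x y} → x ≡ y mod m → + m Signed.∣ x - y
  ≡-mod⇒∣ {x} {y} (≡-mod m∣x-y) = Signed.∣ᵤ⇒∣ {+ m} {x - y} m∣x-y

  ∣⇒≡-mod : ∀ {x y} → + m Signed.∣ x - y → x ≡ y mod m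
  ∣⇒≡-mod m∣x-y = ≡-mod (Signed.∣⇒∣ᵤ m∣x-y)

  ≡-mod-refl : ∀ x → x ≡ x mod m
  ≡-mod-refl x = ≡-mod (subst (λ t → m ∣ ∣ t ∣) (sym (ℤ.+-inverseʳ x)) (m ∣0))

  ≡-mod-sym : ∀ {x y} → x ≡ y mod m → y ≡ x mod m
  ≡-mod-sym {x} {y} (≡-mod m∣x-y) =
    ≡-mod (subst (m ∣_) (trans (sym (ℤ.∣-i∣≡∣i∣ (x - y))) (cong ∣_∣ (negate-difference x y))) m∣x-y)
    where
    negate-difference : ∀ x y → - (x - y) ≡ y - x
    negate-difference = solve-∀

  ≡-mod-trans : ∀ {x y z} → x ≡ y mod m → y ≡ z mod m → x ≡ z mod m
  ≡-mod-trans {x} {y} {z} x≡y y≡z = ∣⇒≡-mod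
    (subst (+ m Signed.∣_) (telescope x y z) (Signed.∣m∣n⇒∣m+n (≡-mod⇒∣ x≡y) (≡-mod⇒∣ y≡z)))
    where
    telescope : ∀ x y z → (x - y) + (y - z) ≡ x - z
    telescope = solve-∀

≡-mod-∣ : ∀ {d m x y} → d ∣ m → x ≡ y mod m → x ≡ y mod d
≡-mod-∣ d∣m (≡-mod m∣x-y) = ≡-mod (∣-trans d∣m m∣x-y)

≡-mod-1 : ∀ x y → x ≡ y mod 1
≡-mod-1 x y = ≡-mod (1∣ ∣ x - y ∣)

≡-mod-unit : ∀ {m} x y → m ≡ 1 → x ≡ y mod m
≡-mod-unit x y refl = ≡-mod-1 x y

≡-mod-lcm : ∀ {a b x y} → x ≡ y mod a → x ≡ y mod b → x ≡ y mod lcm a b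
≡-mod-lcm (≡-mod a∣x-y) (≡-mod b∣x-y) = ≡-mod (lcm-least a∣x-y b∣x-y)

≡-mod-gcd : ∀ {a b x y z} → z ≡ x mod a → z ≡ y mod b → x ≡ y mod gcd a b
≡-mod-gcd {a} {b} z≡x z≡y =
  ≡-mod-trans (≡-mod-sym (≡-mod-∣ (gcd[m,n]∣m a b) z≡x)) (≡-mod-∣ (gcd[m,n]∣n a b) z≡y)

gcd-unitˡ : ∀ {a} b → a ≡ 1 → gcd a b ≡ 1
gcd-unitˡ b refl = gcd-zeroˡ b

gcd-unitʳ : ∀ a {b} → b ≡ 1 → gcd a b ≡ 1
gcd-unitʳ a refl = gcd-zeroʳ a

m∣n⇒lcm[m,n]≡n : ∀ {m n} → m ∣ n → lcm m n ≡ n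
m∣n⇒lcm[m,n]≡n {m} {n} m∣n = ∣-antisym (lcm-least m∣n ∣-refl) (n∣lcm[m,n] m n)

n∣m⇒lcm[m,n]≡m : ∀ {m n} → n ∣ m → lcm m n ≡ m
n∣m⇒lcm[m,n]≡m {m} {n} n∣m = ∣-antisym (lcm-least ∣-refl n∣m) (m∣lcm[m,n] m n)

∣gcd*gcd : ∀ {d} a b c e →
  d ∣ a ℕ.* c → d ∣ a ℕ.* e → d ∣ b ℕ.* c → d ∣ b ℕ.* e → d ∣ gcd a b ℕ.* gcd c e
∣gcd*gcd {d} a b c e d∣ac d∣ae d∣bc d∣be =
  subst (d ∣_) gcd[aG,bG]≡gcd[a,b]*G
    (gcd-greatest (∣x*G a d∣ac d∣ae) (∣x*G b d∣bc d∣be))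
  where
  G : ℕ
  G = gcd c e
  ∣x*G : ∀ x → d ∣ x ℕ.* c → d ∣ x ℕ.* e → d ∣ x ℕ.* G
  ∣x*G x d∣xc d∣xe = subst (d ∣_) (sym (c*gcd[m,n]≡gcd[cm,cn] x c e)) (gcd-greatest d∣xc d∣xe)
  gcd[aG,bG]≡gcd[a,b]*G : gcd (a ℕ.* G) (b ℕ.* G) ≡ gcd a b ℕ.* G
  gcd[aG,bG]≡gcd[a,b]*G = begin
    gcd (a ℕ.* G) (b ℕ.* G) ≡⟨ cong₂ gcd (ℕ.*-comm a G) (ℕ.*-comm b G) ⟩
    gcd (G ℕ.* a) (G ℕ.* b) ≡⟨ c*gcd[m,n]≡gcd[cm,cn] G a b ⟨
    G ℕ.* gcd a b           ≡⟨ ℕ.*-comm G (gcd a b) ⟩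
    gcd a b ℕ.* G           ∎
    where open ≡-Reasoning

-- For c ≠ 0, with u = gcd a c, v = gcd b c and w = gcd u v, one has
-- e · w ∣ u · v = lcm u v · w for e = gcd (lcm a b) c, and w ≠ 0 cancels.
gcd[lcm[a,b],c]∣lcm[gcd[a,c],gcd[b,c]] : ∀ a b c → gcd (lcm a b) c ∣ lcm (gcd a c) (gcd b c)
gcd[lcm[a,b],c]∣lcm[gcd[a,c],gcd[b,c]] a b zero = ∣-reflexive
  (trans (gcd-identityʳ (lcm a b)) (sym (cong₂ lcm (gcd-identityʳ a) (gcd-identityʳ b))))
gcd[lcm[a,b],c]∣lcm[gcd[a,c],gcd[b,c]] a b c@(suc _) =
  *-cancelʳ-∣ w {{≢-nonZero w≢0}} ew∣lcm[u,v]*w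
  where
  u v w e : ℕ
  u = gcd a c
  v = gcd b c
  w = gcd u v
  e = gcd (lcm a b) c
  w≢0 : w ≢ 0
  w≢0 = gcd[m,n]≢0 u v (inj₁ (gcd[m,n]≢0 a c (inj₂ λ ())))
  e∣c : e ∣ c
  e∣c = gcd[m,n]∣n (lcm a b) c
  w∣a : w ∣ a
  w∣a = ∣-trans (gcd[m,n]∣m u v) (gcd[m,n]∣m a c)
  w∣b : w ∣ b
  w∣b = ∣-trans (gcd[m,n]∣n u v) (gcd[m,n]∣m b c)
  w∣c : w ∣ c
  w∣c = ∣-trans (gcd[m,n]∣m u v) (gcd[m,n]∣n a c)
  ew∣ab : e ℕ.* w ∣ a ℕ.* b
  ew∣ab = subst (e ℕ.* w ∣_) (trans (ℕ.*-comm (lcm a b) (gcd a b)) (gcd*lcm a b))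
                (*-pres-∣ (gcd[m,n]∣m (lcm a b) c) (gcd-greatest w∣a w∣b))
  ew∣ac : e ℕ.* w ∣ a ℕ.* c
  ew∣ac = subst (e ℕ.* w ∣_) (ℕ.*-comm c a) (*-pres-∣ e∣c w∣a)
  ew∣lcm[u,v]*w : e ℕ.* w ∣ lcm u v ℕ.* w
  ew∣lcm[u,v]*w = begin
    e ℕ.* w       ∣⟨ ∣gcd*gcd a c b c ew∣ab ew∣ac (*-pres-∣ e∣c w∣b) (*-pres-∣ e∣c w∣c) ⟩
    u ℕ.* v       ≡⟨ gcd*lcm u v ⟨
    w ℕ.* lcm u v ≡⟨ ℕ.*-comm w (lcm u v) ⟩
    lcm u v ℕ.* w ∎
    where open ∣-Reasoning

private
  cast : ∀ d p q r s → d ℕ.+ p ℕ.* q ≡ r ℕ.* s → + d ≡ + r * + s - + p * + q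
  cast d p q r s eq = begin
    + d                               ≡⟨ add-subtract (+ d) (+ p * + q) ⟩
    + d + + p * + q - + p * + q       ≡⟨ cong (λ t → + d + t - + p * + q) (ℤ.pos-* p q) ⟨
    + d + + (p ℕ.* q) - + p * + q     ≡⟨ cong (_- + p * + q) (ℤ.pos-+ d (p ℕ.* q)) ⟨
    + (d ℕ.+ p ℕ.* q) - + p * + q     ≡⟨ cong (λ t → + t - + p * + q) eq ⟩
    + (r ℕ.* s) - + p * + q           ≡⟨ cong (_- + p * + q) (ℤ.pos-* r s) ⟩
    + r * + s - + p * + q             ∎
    where
    open ≡-Reasoning
    add-subtract : ∀ a b → a ≡ a + b - b
    add-subtract = solve-∀

bézout : ∀ m n → Σ ℤ λ x → Σ ℤ λ y → + gcd m n ≡ x * + m + y * + n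
bézout m n with Bézout.identity (gcd-GCD m n)
... | Bézout.+- x y eq =
  + x , - + y , trans (cast (gcd m n) y n x m eq) (subtract-as-add (+ x * + m) (+ y) (+ n))
  where
  subtract-as-add : ∀ a b c → a - b * c ≡ a + (- b) * c
  subtract-as-add = solve-∀
... | Bézout.-+ x y eq =
  - + x , + y , trans (cast (gcd m n) x m y n eq) (swap-difference (+ y * + n) (+ x) (+ m))
  where
  swap-difference : ∀ a b c → a - b * c ≡ (- b) * c + a
  swap-difference = solve-∀

-- If r - s = k · gcd a b and gcd a b = x a + y b, then z = s + k y b = r - k x a.
chineseRemainder₂ : ∀ a b {r s} → r ≡ s mod gcd a b → Σ ℤ λ z → z ≡ r mod a × z ≡ s mod b
chineseRemainder₂ a b {r} {s} r≡s with bézout a b | ≡-mod⇒∣ r≡s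
... | x , y , g≡xa+yb | Signed.divides k r-s≡kg =
  z , ∣⇒≡-mod (Signed.divides (- (k * x)) z-r≡) , ∣⇒≡-mod (Signed.divides (k * y) (cancel s (k * y) (+ b)))
  where
  z : ℤ
  z = s + k * y * + b
  cancel : ∀ s t u → s + t * u - s ≡ t * u
  cancel = solve-∀
  z-r≡ : z - r ≡ - (k * x) * + a
  z-r≡ = begin
    s + k * y * + b - r                      ≡⟨ shift s (k * y * + b) r ⟩
    k * y * + b - (r - s)                    ≡⟨ cong (λ t → k * y * + b - t) r-s≡kg ⟩
    k * y * + b - k * + gcd a b              ≡⟨ cong (λ t → k * y * + b - k * t) g≡xa+yb ⟩
    k * y * + b - k * (x * + a + y * + b)    ≡⟨ expand k x y (+ a) (+ b) ⟩
    - (k * x) * + a                          ∎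
    where
    open ≡-Reasoning
    shift : ∀ s t r → s + t - r ≡ t - (r - s)
    shift = solve-∀
    expand : ∀ k x y a b → k * y * b - k * (x * a + y * b) ≡ - (k * x) * a
    expand = solve-∀

m[i]∣foldr-lcm : ∀ {n} (m : Fin n → ℕ) i → m i ∣ foldr lcm 1 m
m[i]∣foldr-lcm m f0     = m∣lcm[m,n] (m f0) (foldr lcm 1 (tail m))
m[i]∣foldr-lcm m (fs i) =
  ∣-trans (m[i]∣foldr-lcm (tail m) i) (n∣lcm[m,n] (m f0) (foldr lcm 1 (tail m)))

≡-mod-gcd-foldr-lcm : ∀ {n} (m : Fin n → ℕ) c {x y} →
  (∀ i → x ≡ y mod gcd (m i) c) → x ≡ y mod gcd (foldr lcm 1 m) c
≡-mod-gcd-foldr-lcm {zero}  m c {x} {y} _ = ≡-mod-unit x y (gcd-zeroˡ c)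
≡-mod-gcd-foldr-lcm {suc n} m c x≡y = ≡-mod-∣
  (gcd[lcm[a,b],c]∣lcm[gcd[a,c],gcd[b,c]] (m f0) (foldr lcm 1 (tail m)) c)
  (≡-mod-lcm (x≡y f0) (≡-mod-gcd-foldr-lcm (tail m) c (λ i → x≡y (fs i))))

chineseRemainder : ∀ {n} (m : Fin n → ℕ) (r : Fin n → ℤ) →
  (∀ i j → r i ≡ r j mod gcd (m i) (m j)) → Σ ℤ λ z → ∀ i → z ≡ r i mod m i
chineseRemainder {zero}  m r _ = + 0 , λ ()
chineseRemainder {suc n} m r compatible = z′ , z′≡r
  where
  L : ℕ
  L = foldr lcm 1 (tail m)
  tail-solution : Σ ℤ λ z → ∀ i → z ≡ r (fs i) mod m (fs i)
  tail-solution = chineseRemainder (tail m) (tail r) (λ i j → compatible (fs i) (fs j))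
  z : ℤ
  z = proj₁ tail-solution
  z≡r : ∀ i → z ≡ r (fs i) mod m (fs i)
  z≡r = proj₂ tail-solution
  z≡r₀ : z ≡ r f0 mod gcd L (m f0)
  z≡r₀ = ≡-mod-gcd-foldr-lcm (tail m) (m f0)
    (λ i → ≡-mod-trans (≡-mod-∣ (gcd[m,n]∣m (m (fs i)) (m f0)) (z≡r i)) (compatible (fs i) f0))
  combined : Σ ℤ λ z′ → z′ ≡ z mod L × z′ ≡ r f0 mod m f0
  combined = chineseRemainder₂ L (m f0) z≡r₀
  z′ : ℤ
  z′ = proj₁ combined
  z′≡r : ∀ i → z′ ≡ r i mod m i
  z′≡r f0     = proj₂ (proj₂ combined)
  z′≡r (fs i) = ≡-mod-trans (≡-mod-∣ (m[i]∣foldr-lcm (tail m) i) (proj₁ (proj₂ combined))) (z≡r i)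

-- Star-clique on edge weights

-- A missing edge imposes only the trivial congruence modulo 1.
weight : Maybe ℕ → ℕ
weight nothing  = 1
weight (just a) = a

IsSplineʷ : ∀ {n} → WGraph n → (Fin n → ℤ) → Set
IsSplineʷ W g = ∀ k l → g k ≡ g l mod weight (W k l)

module _ {n} {W : WGraph n} {g : Fin n → ℤ} where

  isSpline⇒isSplineʷ : IsSpline W g → IsSplineʷ W g
  isSpline⇒isSplineʷ sp k l with W k l in eq
  ... | nothing = ≡-mod-1 (g k) (g l)
  ... | just a  = ≡-mod (sp k l a eq)

  isSplineʷ⇒isSpline : IsSplineʷ W g → IsSpline W g
  isSplineʷ⇒isSpline sp k l a eq = divisibility (subst (λ e → g k ≡ g l mod weight e) eq (sp k l))

weight-collapse : ∀ e f → weight (collapse e f) ≡ lcm (weight e) (weight f)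
weight-collapse nothing  f        = sym (m∣n⇒lcm[m,n]≡n (1∣ weight f))
weight-collapse (just a) nothing  = sym (n∣m⇒lcm[m,n]≡m (1∣ a))
weight-collapse (just a) (just b) = refl

weight-cliqueEdge : ∀ e f → weight (cliqueEdge e f) ≡ gcd (weight e) (weight f)
weight-cliqueEdge nothing  f        = sym (gcd-zeroˡ (weight f))
weight-cliqueEdge (just a) nothing  = sym (gcd-zeroʳ a)
weight-cliqueEdge (just a) (just b) = refl

cliqueEdge-comm : ∀ e f → cliqueEdge e f ≡ cliqueEdge f e
cliqueEdge-comm nothing  nothing  = refl
cliqueEdge-comm nothing  (just _) = refl
cliqueEdge-comm (just _) nothing  = refl
cliqueEdge-comm (just a) (just b) = cong just (gcd-comm a b)

data StarCliqueView {n} (v : Fin n) (W : WGraph n) (x y : Fin n) : ℕ → Set where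
  incident : x ≡ v ⊎ y ≡ v → StarCliqueView v W x y 1
  diagonal : x ≢ v → x ≡ y → StarCliqueView v W x y (weight (W x y))
  clique   : x ≢ v → y ≢ v → x ≢ y →
             StarCliqueView v W x y (lcm (weight (W x y)) (gcd (weight (W v x)) (weight (W v y))))

starCliqueView : ∀ {n} (v : Fin n) W x y →
  StarCliqueView v W x y (weight (starCliqueCollapse v W x y))
starCliqueView v W x y with x ≟ v | y ≟ v | x ≟ y
... | yes x≡v | _       | _       = incident (inj₁ x≡v)
... | no _    | yes y≡v | _       = incident (inj₂ y≡v)
... | no x≢v  | no _    | yes x≡y = diagonal x≢v x≡y
... | no x≢v  | no y≢v  | no x≢y  = subst (StarCliqueView v W x y) (sym weight≡) (clique x≢v y≢v x≢y)
  where
  weight≡ : weight (collapse (W x y) (cliqueEdge (W v x) (W v y)))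
          ≡ lcm (weight (W x y)) (gcd (weight (W v x)) (weight (W v y)))
  weight≡ = trans (weight-collapse (W x y) _)
                  (cong (lcm (weight (W x y))) (weight-cliqueEdge (W v x) (W v y)))

isSplineʷ-starCliqueCollapse : ∀ {n} (v : Fin n) W g →
  IsSplineʷ W g → IsSplineʷ (starCliqueCollapse v W) g
isSplineʷ-starCliqueCollapse v W g sp x y = congruence (starCliqueView v W x y)
  where
  congruence : ∀ {w} → StarCliqueView v W x y w → g x ≡ g y mod w
  congruence (incident _)   = ≡-mod-1 (g x) (g y)
  congruence (diagonal _ _) = sp x y
  congruence (clique _ _ _) = ≡-mod-lcm (sp x y) (≡-mod-gcd (sp v x) (sp v y))

reduceAlong-preserves : ∀ {n} (P : WGraph n → Set) → (∀ v W → P W → P (starCliqueCollapse v W)) →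
  ∀ vs W → P W → P (reduceAlong vs W)
reduceAlong-preserves P step []       W pW = pW
reduceAlong-preserves P step (v ∷ vs) W pW = reduceAlong-preserves P step vs _ (step v W pW)

isSpline-reduceAlong : ∀ {n} vs (W : WGraph n) g → IsSpline W g → IsSpline (reduceAlong vs W) g
isSpline-reduceAlong vs W g = isSplineʷ⇒isSpline
  ∘ reduceAlong-preserves (λ U → IsSplineʷ U g) (λ v U → isSplineʷ-starCliqueCollapse v U g) vs W
  ∘ isSpline⇒isSplineʷ

record IsUndirected {n} (W : WGraph n) : Set where
  field
    loopless  : ∀ k → W k k ≡ nothing
    symmetric : ∀ k l → W k l ≡ W l k
open IsUndirected

isSimple⇒isUndirected : ∀ {n} {W : WGraph n} → IsSimpleWGraph W → IsUndirected W
isSimple⇒isUndirected simple = record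
  { loopless = IsSimpleWGraph.loopless simple ; symmetric = IsSimpleWGraph.symmetric simple }

isUndirected-starCliqueCollapse : ∀ {n} (v : Fin n) W →
  IsUndirected W → IsUndirected (starCliqueCollapse v W)
isUndirected-starCliqueCollapse v W undirected = record { loopless = loopless′ ; symmetric = symmetric′ }
  where
  loopless′ : ∀ k → starCliqueCollapse v W k k ≡ nothing
  loopless′ k with k ≟ v | k ≟ k
  ... | yes _ | _       = refl
  ... | no _  | yes _   = loopless undirected k
  ... | no _  | no k≢k  = contradiction refl k≢k
  symmetric′ : ∀ k l → starCliqueCollapse v W k l ≡ starCliqueCollapse v W l k
  symmetric′ k l with k ≟ v | l ≟ v | k ≟ l | l ≟ k
  ... | yes _ | yes _ | _       | _       = refl
  ... | yes _ | no _  | _       | _       = refl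
  ... | no _  | yes _ | _       | _       = refl
  ... | no _  | no _  | yes _   | yes _   = symmetric undirected k l
  ... | no _  | no _  | yes k≡l | no l≢k  = contradiction (sym k≡l) l≢k
  ... | no _  | no _  | no k≢l  | yes l≡k = contradiction (sym l≡k) k≢l
  ... | no _  | no _  | no _    | no _    =
    cong₂ collapse (symmetric undirected k l) (cliqueEdge-comm (W v k) (W v l))

Isolated : ∀ {n} → Fin n → WGraph n → Set
Isolated x W = ∀ y → weight (W x y) ≡ 1 × weight (W y x) ≡ 1

isolated-starCliqueCollapse-self : ∀ {n} (v : Fin n) W → Isolated v (starCliqueCollapse v W)
isolated-starCliqueCollapse-self v W y = row (starCliqueView v W v y) , column (starCliqueView v W y v)
  where
  row : ∀ {w} → StarCliqueView v W v y w → w ≡ 1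
  row (incident _)     = refl
  row (diagonal v≢v _) = contradiction refl v≢v
  row (clique v≢v _ _) = contradiction refl v≢v
  column : ∀ {w} → StarCliqueView v W y v w → w ≡ 1
  column (incident _)       = refl
  column (diagonal y≢v y≡v) = contradiction y≡v y≢v
  column (clique _ v≢v _)   = contradiction refl v≢v

isolated-starCliqueCollapse : ∀ {n} (u : Fin n) W {x} → Isolated x W → Isolated x (starCliqueCollapse u W)
isolated-starCliqueCollapse u W {x} isolated y =
  unit (starCliqueView u W x y) (proj₁ (isolated y)) (inj₁ (proj₂ (isolated u))) ,
  unit (starCliqueView u W y x) (proj₂ (isolated y)) (inj₂ (proj₂ (isolated u)))
  where
  unit : ∀ {s t w} → StarCliqueView u W s t w → weight (W s t) ≡ 1 →
         weight (W u s) ≡ 1 ⊎ weight (W u t) ≡ 1 → w ≡ 1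
  unit (incident _)   _    _ = refl
  unit (diagonal _ _) st≡1 _ = st≡1
  unit {s} {t} (clique _ _ _) st≡1 us⊎ut≡1 = begin
    lcm (weight (W s t)) (gcd (weight (W u s)) (weight (W u t))) ≡⟨ cong₂ lcm st≡1 (gcd≡1 us⊎ut≡1) ⟩
    lcm 1 1                                                      ≡⟨ m∣n⇒lcm[m,n]≡n (1∣ 1) ⟩
    1                                                            ∎
    where
    open ≡-Reasoning
    gcd≡1 : weight (W u s) ≡ 1 ⊎ weight (W u t) ≡ 1 → gcd (weight (W u s)) (weight (W u t)) ≡ 1
    gcd≡1 (inj₁ us≡1) = gcd-unitˡ (weight (W u t)) us≡1
    gcd≡1 (inj₂ ut≡1) = gcd-unitʳ (weight (W u s)) ut≡1

isolated-reduceAlong : ∀ {n} vs (W : WGraph n) {x} → x ∈ vs → Isolated x (reduceAlong vs W)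
isolated-reduceAlong (x ∷ vs) W (here refl) =
  reduceAlong-preserves (Isolated x) (λ u U → isolated-starCliqueCollapse u U) vs _
    (isolated-starCliqueCollapse-self x W)
isolated-reduceAlong (_ ∷ vs) W (there x∈vs) = isolated-reduceAlong vs _ x∈vs

gcd-neighbours-≡-mod : ∀ {n} {v : Fin n} {W x y w} (g : Fin n → ℤ) → IsUndirected W →
  StarCliqueView v W x y w → g x ≡ g y mod w → g x ≡ g y mod gcd (weight (W v x)) (weight (W v y))
gcd-neighbours-≡-mod {v = v} {W} {y = y} g undirected (incident (inj₁ refl)) _ =
  ≡-mod-unit (g v) (g y) (gcd-unitˡ (weight (W v y)) (cong weight (loopless undirected v)))
gcd-neighbours-≡-mod {v = v} {W} {x = x} g undirected (incident (inj₂ refl)) _ =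
  ≡-mod-unit (g x) (g v) (gcd-unitʳ (weight (W v x)) (cong weight (loopless undirected v)))
gcd-neighbours-≡-mod g _ (diagonal _ refl) _ = ≡-mod-refl _
gcd-neighbours-≡-mod {v = v} {W} {x} {y} g _ (clique _ _ _) gx≡gy =
  ≡-mod-∣ (n∣lcm[m,n] (weight (W x y)) (gcd (weight (W v x)) (weight (W v y)))) gx≡gy

extend-starCliqueCollapse : ∀ {n} (v : Fin n) W → IsUndirected W →
  ∀ g → IsSplineʷ (starCliqueCollapse v W) g →
  Σ (Fin n → ℤ) λ g′ → IsSplineʷ W g′ × (∀ k → k ≢ v → g′ k ≡ g k)
extend-starCliqueCollapse {n} v W undirected g sp =
  g′ , sp′ , λ k k≢v → updateAt-minimal k v {const z} g k≢v
  where
  solution : Σ ℤ λ z → ∀ x → z ≡ g x mod weight (W v x)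
  solution = chineseRemainder (λ x → weight (W v x)) g
    (λ x y → gcd-neighbours-≡-mod g undirected (starCliqueView v W x y) (sp x y))
  z : ℤ
  z = proj₁ solution
  z≡g : ∀ x → z ≡ g x mod weight (W v x)
  z≡g = proj₂ solution
  g′ : Fin n → ℤ
  g′ = updateAt g v (const z)
  off-v : ∀ {k l w} → k ≢ v → l ≢ v →
          StarCliqueView v W k l w → g k ≡ g l mod w → g k ≡ g l mod weight (W k l)
  off-v k≢v l≢v (incident k⊎l≡v) _ = contradiction k⊎l≡v [ k≢v , l≢v ]
  off-v _   _   (diagonal _ _)   gk≡gl = gk≡gl
  off-v {k} {l} _ _ (clique _ _ _) gk≡gl =
    ≡-mod-∣ (m∣lcm[m,n] (weight (W k l)) (gcd (weight (W v k)) (weight (W v l)))) gk≡gl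
  sp′ : IsSplineʷ W g′
  sp′ k l with k ≟ v | l ≟ v
  ... | yes refl | yes refl = ≡-mod-refl (g′ k)
  ... | yes refl | no l≢v
    rewrite updateAt-updates v {const z} g | updateAt-minimal l v {const z} g l≢v = z≡g l
  ... | no k≢v | yes refl
    rewrite updateAt-updates v {const z} g | updateAt-minimal k v {const z} g k≢v
          | symmetric undirected k v = ≡-mod-sym (z≡g k)
  ... | no k≢v | no l≢v
    rewrite updateAt-minimal k v {const z} g k≢v | updateAt-minimal l v {const z} g l≢v =
    off-v k≢v l≢v (starCliqueView v W k l) (sp k l)

extend-reduceAlong : ∀ {n} vs (W : WGraph n) → IsUndirected W →
  ∀ g → IsSplineʷ (reduceAlong vs W) g →
  Σ (Fin n → ℤ) λ g′ → IsSplineʷ W g′ × (∀ k → k ∉ vs → g′ k ≡ g k)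
extend-reduceAlong []       W _          g sp = g , sp , λ _ _ → refl
extend-reduceAlong (v ∷ vs) W undirected g sp
  with extend-reduceAlong vs (starCliqueCollapse v W) (isUndirected-starCliqueCollapse v W undirected) g sp
... | g₁ , sp₁ , g₁≡g with extend-starCliqueCollapse v W undirected g₁ sp₁
... | g₂ , sp₂ , g₂≡g₁ =
  g₂ , sp₂ , λ k k∉v∷vs → trans (g₂≡g₁ k (k∉v∷vs ∘ here)) (g₁≡g k (k∉v∷vs ∘ there))

-- Restriction to the two surviving vertices

restrict2-isSpline : ∀ {n} (B : WGraph n) i j g →
  IsSpline B g → IsSpline (twoVertexGraph B i j) (restrict2 i j g)
restrict2-isSpline B i j g sp f0           (fs f0)      = sp i j
restrict2-isSpline B i j g sp (fs f0)      f0           = sp j i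
restrict2-isSpline B i j g sp f0           f0           _ ()
restrict2-isSpline B i j g sp (fs f0)      (fs f0)      _ ()
restrict2-isSpline B i j g sp f0           (fs (fs ()))
restrict2-isSpline B i j g sp (fs f0)      (fs (fs ()))
restrict2-isSpline B i j g sp (fs (fs ())) _

restrict2-linear : ∀ {n} (i j : Fin n) c g h (t : Fin 2) →
  restrict2 i j (λ k → c * g k + h k) t ≡ c * restrict2 i j g t + restrict2 i j h t
restrict2-linear i j c g h f0     = refl
restrict2-linear i j c g h (fs _) = refl

twoValued : ∀ {n} → Fin n → (Fin 2 → ℤ) → Fin n → ℤ
twoValued i h k = if does (k ≟ i) then h f0 else h (fs f0)

twoValued-at : ∀ {n} (i : Fin n) h → twoValued i h i ≡ h f0
twoValued-at i h rewrite dec-true (i ≟ i) refl = refl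

twoValued-off : ∀ {n} {i k : Fin n} h → k ≢ i → twoValued i h k ≡ h (fs f0)
twoValued-off {i = i} {k} h k≢i rewrite dec-false (k ≟ i) k≢i = refl

classify : ∀ {n} (i j k : Fin n) → k ≡ i ⊎ k ≡ j ⊎ (k ≢ i × k ≢ j)
classify i j k with k ≟ i | k ≟ j
... | yes k≡i | _       = inj₁ k≡i
... | no _    | yes k≡j = inj₂ (inj₁ k≡j)
... | no k≢i  | no k≢j  = inj₂ (inj₂ (k≢i , k≢j))

isSplineʷ-twoValued : ∀ {n} (B : WGraph n) {i j} h → i ≢ j →
  (∀ k → k ≢ i → k ≢ j → Isolated k B) →
  IsSpline (twoVertexGraph B i j) h → IsSplineʷ B (twoValued i h)
isSplineʷ-twoValued B {i} {j} h i≢j isolated sh k l with classify i j k | classify i j l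
... | inj₂ (inj₂ (k≢i , k≢j)) | _ = ≡-mod-unit _ _ (proj₁ (isolated k k≢i k≢j l))
... | _ | inj₂ (inj₂ (l≢i , l≢j)) = ≡-mod-unit _ _ (proj₂ (isolated l l≢i l≢j k))
... | inj₁ refl        | inj₁ refl        = ≡-mod-refl _
... | inj₂ (inj₁ refl) | inj₂ (inj₁ refl) = ≡-mod-refl _
... | inj₁ refl        | inj₂ (inj₁ refl)
  rewrite twoValued-at i h | twoValued-off h (i≢j ∘ sym) = edge f0 (fs f0)
  where
  edge : IsSplineʷ (twoVertexGraph B i j) h
  edge = isSpline⇒isSplineʷ sh
... | inj₂ (inj₁ refl) | inj₁ refl
  rewrite twoValued-at i h | twoValued-off h (i≢j ∘ sym) = edge (fs f0) f0
  where
  edge : IsSplineʷ (twoVertexGraph B i j) h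
  edge = isSpline⇒isSplineʷ sh

restrict2-lift : ∀ {n} (A : WGraph n) → IsSimpleWGraph A → ∀ {i j} → i ≢ j →
  ∀ vs → i ∉ vs → j ∉ vs → (∀ k → k ≢ i → k ≢ j → k ∈ vs) →
  ∀ h → IsSpline (twoVertexGraph (reduceAlong vs A) i j) h →
  Σ (Fin n → ℤ) λ g → IsSpline A g × (∀ t → restrict2 i j g t ≡ h t)
restrict2-lift A simple {i} {j} i≢j vs i∉vs j∉vs covers h sh
  with extend-reduceAlong vs A (isSimple⇒isUndirected simple) (twoValued i h)
         (isSplineʷ-twoValued (reduceAlong vs A) h i≢j
            (λ k k≢i k≢j → isolated-reduceAlong vs A (covers k k≢i k≢j)) sh)
... | g , sp , g≡twoValued = g , isSplineʷ⇒isSpline sp , restricts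
  where
  restricts : ∀ t → restrict2 i j g t ≡ h t
  restricts f0           = trans (g≡twoValued i i∉vs) (twoValued-at i h)
  restricts (fs f0)      = trans (g≡twoValued j j∉vs) (twoValued-off h (i≢j ∘ sym))
  restricts (fs (fs ()))

corollary3p9 : (n : ℕ) (A : WGraph n) → IsSimpleWGraph A →
    (i j : Fin n) → ¬ (i ≡ j) →
    (vs : List (Fin n)) → Unique vs → i ∉ vs → j ∉ vs →
    (∀ k → ¬ (k ≡ i) → ¬ (k ≡ j) → k ∈ vs) →
    let H = twoVertexGraph (reduceAlong vs A) i j in
    ((g : Fin n → ℤ) → IsSpline A g → IsSpline H (restrict2 i j g))
    × ((c : ℤ) (g h : Fin n → ℤ) (t : Fin 2) →
         restrict2 i j (λ k → c * g k + h k) t ≡ c * restrict2 i j g t + restrict2 i j h t)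
    × ((h : Fin 2 → ℤ) → IsSpline H h →
         Σ (Fin n → ℤ) (λ g → IsSpline A g × ((t : Fin 2) → restrict2 i j g t ≡ h t)))
corollary3p9 n A simple i j i≢j vs _ i∉vs j∉vs covers =
    (λ g sp → restrict2-isSpline (reduceAlong vs A) i j g (isSpline-reduceAlong vs A g sp))
  , restrict2-linear i j
  , restrict2-lift A simple i≢j vs i∉vs j∉vs covers
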